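{- Let $n$ be a positive integer, $j = 2n+1$, $k$ a positive integer, $D = \{1,j,k\}$, and write $k = m(j+1) + \overline{k}$ with integers $m \geq 0$ and $0 \leq \overline{k} \leq j$. Then for every positive integer $a$, \[ \kappa(D) \geq \begin{cases} \frac{k/2 - am}{k+1} & \text{if } \frac{n-a-2am}{a} \leq \overline{k} \leq \frac{n-a+1}{a},\\[4pt] \frac{k/2 - am - a + 1}{k+1} & \text{if } \frac{2an - n - a - 2am}{a} \leq \overline{k} \leq \frac{2an - n + a - 1}{a}. \end{cases} \]
   Context: For a real $x$, $\|x\|$ denotes the distance from $x$ to the nearest integer, and for a set $D$ of positive integers $\kappa(D) = \sup_{t \in \mathbb{R}} \min_{d \in D} \|td\|$. -}

module Defs where

open import Data.Nat using (ℕ)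
open import Data.Integer using (ℤ; +_)
open import Data.Rational using (ℚ; floor; _-_; _*_; _⊓_; _≤_; _<_; 0ℚ; 1ℚ; _/_)
open import Data.List using (List)
open import Data.List.Relation.Unary.All using (All)
open import Data.Product using (∃-syntax)

ℕ→ℚ : ℕ → ℚ
ℕ→ℚ n = (+ n) / 1

-- ‖x‖ : distance from x to the nearest integer.
-- The nearest integers to x are floor x and floor x + 1, so
-- ‖x‖ = min (x - ⌊x⌋) (⌊x⌋ + 1 - x).
‖_‖ : ℚ → ℚ
‖ x ‖ = (x - ((floor x) / 1)) ⊓ (1ℚ - (x - ((floor x) / 1)))

-- "κ(D) ≥ c", where κ(D) = sup_t min_{d ∈ D} ‖t d‖ :
-- for every ε > 0 there is t with ‖t d‖ ≥ c - ε for all d ∈ D.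
-- (t ranges over ℚ; since t ↦ min_d ‖td‖ is continuous, the sup over ℚ
-- equals the sup over ℝ.)
κ≥ : List ℕ → ℚ → Set
κ≥ D c = ∀ (ε : ℚ) → 0ℚ < ε →
  ∃[ t ] All (λ d → c - ε ≤ ‖ t * ℕ→ℚ d ‖) D

-- For even k = 2K take t = (K + A + 1)/(2K + 1). Then t·1 and t·k lie at distance exactly
-- (K − A)/(2K + 1) = (k/2 − A)/(k + 1) from the integers 1 and K + A, and t·j = t(2n + 1) keeps
-- at least that distance from the integers as soon as a(k + 1)/(2A + 1) ∈ [n, n + 1]. For odd k every element
-- of D is odd, so t = 1/2 gives ‖td‖ = 1/2, which exceeds the bound. With A = am, resp.
-- A = am + a − 1, the two ranges for k̄ in the statement are exactly that condition on a(k + 1)/(2A + 1).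
module Submission where

open import Data.Nat as N using (ℕ; zero; suc)
import Data.Nat.Properties as NP
open import Data.Integer as Z using (ℤ; +_; +[1+_]; _+_; _*_; _-_; -_; _≤_; _<_; 0ℤ; 1ℤ)
import Data.Integer.Properties as ZP
import Data.Integer.DivMod as ZD
open import Data.Integer.Tactic.RingSolver using (solve-∀)
open import Data.Rational as Q using (ℚ; mkℚ; _/_; floor; toℚᵘ; 0ℚ; 1ℚ; ↥_; ↧_)
import Data.Rational.Properties as QP
open import Data.Rational.Unnormalised using (mkℚᵘ; *≡*; *≤*) renaming (_≃_ to _≃ᵘ_)
import Data.Rational.Unnormalised.Properties as UP
open import Data.Product using (_×_; _,_)
open import Data.List using (List; _∷_; [])
open import Data.List.Relation.Unary.All as All using (All; _∷_; [])
open import Relation.Binary.PropositionalEquality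
open import Relation.Nullary using (yes; no)
open import Data.Maybe using (Maybe; just; nothing)
open import Level using (0ℓ)
import Tactic.RingSolver as RingSolver
import Tactic.RingSolver.Core.AlmostCommutativeRing as ACR
import Data.Nat.Tactic.RingSolver as NSolver
open import Defs

toℚᵘ-/ : ∀ i d → toℚᵘ (i / suc d) ≃ᵘ mkℚᵘ i d
toℚᵘ-/ i d = QP.toℚᵘ-fromℚᵘ (mkℚᵘ i d)

*≡*⇒/≡/ : ∀ i j a b .{{_ : N.NonZero a}} .{{_ : N.NonZero b}} → i * + b ≡ j * + a → i / a ≡ j / b
*≡*⇒/≡/ i j (suc d) (suc e) eq = QP.toℚᵘ-injective
  (UP.≃-trans (toℚᵘ-/ i d) (UP.≃-trans (*≡* eq) (UP.≃-sym (toℚᵘ-/ j e))))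

*≤*⇒/≤/ : ∀ i j a b .{{_ : N.NonZero a}} .{{_ : N.NonZero b}} → i * + b ≤ j * + a → i / a Q.≤ j / b
*≤*⇒/≤/ i j (suc d) (suc e) le = QP.toℚᵘ-cancel-≤
  (UP.≤-respˡ-≃ (UP.≃-sym (toℚᵘ-/ i d)) (UP.≤-respʳ-≃ (UP.≃-sym (toℚᵘ-/ j e)) (*≤* le)))

/≤/⇒*≤* : ∀ i j a b .{{_ : N.NonZero a}} .{{_ : N.NonZero b}} → i / a Q.≤ j / b → i * + b ≤ j * + a
/≤/⇒*≤* i j (suc d) (suc e) le
  with UP.≤-respˡ-≃ (toℚᵘ-/ i d) (UP.≤-respʳ-≃ (toℚᵘ-/ j e) (QP.toℚᵘ-mono-≤ le))
... | *≤* le′ = le′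

/-+-/ : ∀ i j d e → (i / suc d) Q.+ (j / suc e) ≡ (i * +[1+ e ] + j * +[1+ d ]) / (suc d N.* suc e)
/-+-/ i j d e = QP.toℚᵘ-injective (UP.≃-trans (QP.toℚᵘ-homo-+ (i / suc d) (j / suc e))
  (UP.≃-trans (UP.+-cong (toℚᵘ-/ i d) (toℚᵘ-/ j e)) (UP.≃-sym (toℚᵘ-/ _ _))))

/-*-/ : ∀ i j d e → (i / suc d) Q.* (j / suc e) ≡ (i * j) / (suc d N.* suc e)
/-*-/ i j d e = QP.toℚᵘ-injective (UP.≃-trans (QP.toℚᵘ-homo-* (i / suc d) (j / suc e))
  (UP.≃-trans (UP.*-cong (toℚᵘ-/ i d) (toℚᵘ-/ j e)) (UP.≃-sym (toℚᵘ-/ _ _))))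

/-‿-/ : ∀ i j d e → (i / suc d) Q.- (j / suc e) ≡ (i * +[1+ e ] - j * +[1+ d ]) / (suc d N.* suc e)
/-‿-/ i j d e = trans
  (QP.toℚᵘ-injective (UP.≃-trans (QP.toℚᵘ-homo-+ (i / suc d) (Q.- (j / suc e)))
    (UP.≃-trans (UP.+-cong (toℚᵘ-/ i d) (UP.≃-trans (QP.toℚᵘ-homo‿- (j / suc e)) (UP.-‿cong (toℚᵘ-/ j e))))
    (UP.≃-sym (toℚᵘ-/ _ _)))))
  (cong (λ w → (i * +[1+ e ] + w) / (suc d N.* suc e)) (sym (ZP.neg-distribˡ-* j +[1+ d ])))

floor-bounds : ∀ p → floor p * ↧ p ≤ ↥ p × ↥ p < (1ℤ + floor p) * ↧ p
floor-bounds p@(mkℚ n d _) =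
  ZD.[n/d]*d≤n n (↧ p) ,
  subst (λ F → n < (1ℤ + F) * ↧ p) (sym (ZD.div-pos-is-/ℕ n (suc d))) (ZD.n<s[n/ℕd]*d n (suc d))

floor-/-bounds : ∀ X q' → let F = floor (X / suc q') in
                 F * +[1+ q' ] ≤ X × X < (1ℤ + F) * +[1+ q' ]
floor-/-bounds X q' = go (X / suc q') (toℚᵘ-/ X q')
  where
  q : ℤ
  q = +[1+ q' ]
  swap : ∀ F q d → F * q * d ≡ F * d * q
  swap = solve-∀
  go : ∀ p → toℚᵘ p ≃ᵘ mkℚᵘ X q' → floor p * q ≤ X × X < (1ℤ + floor p) * q
  go p@(mkℚ _ _ _) (*≡* ↥p*q≡X*↧p) with floor-bounds p
  ... | F↧p≤↥p , ↥p<[1+F]↧p =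
    ZP.*-cancelʳ-≤-pos (floor p * q) X (↧ p)
      (subst₂ _≤_ (sym (swap (floor p) q (↧ p))) ↥p*q≡X*↧p (ZP.*-monoʳ-≤-nonNeg q F↧p≤↥p)) ,
    ZP.*-cancelʳ-<-nonNeg (↧ p)
      (subst₂ _<_ ↥p*q≡X*↧p (swap (1ℤ + floor p) (↧ p) q) (ZP.*-monoʳ-<-pos q ↥p<[1+F]↧p))

quotient-≤ : ∀ {X F z} q' → F * +[1+ q' ] ≤ X → X < (1ℤ + z) * +[1+ q' ] → F ≤ z
quotient-≤ {z = z} q' Fq≤X X<[1+z]q = subst (_ ≤_) (ZP.pred-suc z)
  (ZP.i<j⇒i≤pred[j] {j = 1ℤ + z} (ZP.*-cancelʳ-<-nonNeg +[1+ q' ] (ZP.≤-<-trans Fq≤X X<[1+z]q)))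

quotient-unique : ∀ {X F z} q' → F * +[1+ q' ] ≤ X → X < (1ℤ + F) * +[1+ q' ] →
                  z * +[1+ q' ] ≤ X → X < (1ℤ + z) * +[1+ q' ] → F ≡ z
quotient-unique q' Fq≤X X<[1+F]q zq≤X X<[1+z]q =
  ZP.≤-antisym (quotient-≤ q' Fq≤X X<[1+z]q) (quotient-≤ q' zq≤X X<[1+F]q)

+≤⇒≤- : ∀ a b c → a + b ≤ c → b ≤ c - a
+≤⇒≤- a b c a+b≤c = subst (_≤ c - a) (cancel a b) (ZP.+-monoˡ-≤ (- a) a+b≤c)
  where
  cancel : ∀ a b → a + b - a ≡ b
  cancel = solve-∀

[1+F]q-X≡q-[X-Fq] : ∀ F q X → (1ℤ + F) * q - X ≡ q - (X - F * q)
[1+F]q-X≡q-[X-Fq] = solve-∀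

remainder-bounds : ∀ {X C F z} q' → let q = +[1+ q' ] in
                   F * q ≤ X → X < (1ℤ + F) * q → z * q + C ≤ X → X + C ≤ (1ℤ + z) * q →
                   C ≤ X - F * q × C ≤ q - (X - F * q)
remainder-bounds {X} {C} {F} {z} q' Fq≤X X<[1+F]q zq+C≤X X+C≤[1+z]q with C Z.≤? 0ℤ
... | yes C≤0 =
  ZP.≤-trans C≤0 (ZP.i≤j⇒0≤j-i Fq≤X) ,
  ZP.≤-trans C≤0 (subst (0ℤ ≤_) ([1+F]q-X≡q-[X-Fq] F q X) (ZP.i≤j⇒0≤j-i (ZP.<⇒≤ X<[1+F]q)))
  where
  q : ℤ
  q = +[1+ q' ]
... | no C≰0 = subst (λ F → C ≤ X - F * q × C ≤ q - (X - F * q)) (sym F≡z)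
  (+≤⇒≤- (z * q) C X zq+C≤X ,
   subst (C ≤_) ([1+F]q-X≡q-[X-Fq] z q X) (+≤⇒≤- X C ((1ℤ + z) * q) X+C≤[1+z]q))
  where
  q : ℤ
  q = +[1+ q' ]
  0<C : 0ℤ < C
  0<C = ZP.≰⇒> C≰0
  F≡z : F ≡ z
  F≡z = quotient-unique q' Fq≤X X<[1+F]q
    (ZP.≤-trans (subst (_≤ z * q + C) (ZP.+-identityʳ (z * q)) (ZP.+-monoʳ-≤ (z * q) (ZP.<⇒≤ 0<C))) zq+C≤X)
    (ZP.<-≤-trans (subst (_< X + C) (ZP.+-identityʳ X) (ZP.+-monoʳ-< X 0<C)) X+C≤[1+z]q)

/-monoˡ-≤ : ∀ {i j} n .{{_ : N.NonZero n}} → i ≤ j → i / n Q.≤ j / n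
/-monoˡ-≤ {i} {j} n i≤j = *≤*⇒/≤/ i j n n (ZP.*-monoʳ-≤-nonNeg (+ n) i≤j)

‖/‖≡ : ∀ X q' → let q = +[1+ q' ]; Y = X - floor (X / suc q') * q in
       ‖ X / suc q' ‖ ≡ (Y / suc q') Q.⊓ ((q - Y) / suc q')
‖/‖≡ X q' = cong₂ Q._⊓_ fract (trans (cong (λ y → 1ℚ Q.- y) fract) one-minus)
  where
  q F Y : ℤ
  q = +[1+ q' ]
  F = floor (X / suc q')
  Y = X - F * q
  fract : X / suc q' Q.- F / 1 ≡ Y / suc q'
  fract = trans (/-‿-/ X F q' 0) (*≡*⇒/≡/ (X * 1ℤ - F * q) Y (suc q' N.* 1) (suc q') (eq X F q))
    where
    eq : ∀ X F q → (X * 1ℤ - F * q) * q ≡ (X - F * q) * (q * 1ℤ)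
    eq = solve-∀
  one-minus : 1ℚ Q.- Y / suc q' ≡ (q - Y) / suc q'
  one-minus = trans (/-‿-/ 1ℤ Y 0 q') (*≡*⇒/≡/ (1ℤ * q - Y * 1ℤ) (q - Y) (1 N.* suc q') (suc q') (eq Y q))
    where
    eq : ∀ Y q → (1ℤ * q - Y * 1ℤ) * q ≡ (q - Y) * (1ℤ * q)
    eq = solve-∀

‖/‖-≥ : ∀ {X C z} q' → z * +[1+ q' ] + C ≤ X → X + C ≤ (1ℤ + z) * +[1+ q' ] →
        C / suc q' Q.≤ ‖ X / suc q' ‖
‖/‖-≥ {X} {C} {z} q' zq+C≤X X+C≤[1+z]q with floor-/-bounds X q'
... | Fq≤X , X<[1+F]q with remainder-bounds {X} {C} {floor (X / suc q')} {z} q' Fq≤X X<[1+F]q zq+C≤X X+C≤[1+z]q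
... | C≤Y , C≤q-Y rewrite ‖/‖≡ X q' = QP.⊓-glb (/-monoˡ-≤ (suc q') C≤Y) (/-monoˡ-≤ (suc q') C≤q-Y)

m+k≤n+r⇒m+[k-r]≤n : ∀ {m n k r} → m N.+ k N.≤ n N.+ r → + m + (+ k - + r) ≤ + n
m+k≤n+r⇒m+[k-r]≤n {m} {n} {k} {r} m+k≤n+r =
  subst₂ _≤_ (trans (cong (_- + r) (ZP.pos-+ m k)) (reassoc (+ m) (+ k) (+ r)))
             (trans (cong (_- + r) (ZP.pos-+ n r)) (cancel (+ n) (+ r)))
             (ZP.+-monoˡ-≤ (- + r) (Z.+≤+ m+k≤n+r))
  where
  reassoc : ∀ m k r → m + k - r ≡ m + (k - r)
  reassoc = solve-∀
  cancel : ∀ n r → n + r - r ≡ n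
  cancel = solve-∀

/·ℕ→ℚ : ∀ T d q' → (+ T / suc q') Q.* ℕ→ℚ d ≡ + (T N.* d) / suc q'
/·ℕ→ℚ T d q' = trans (/-*-/ (+ T) (+ d) q' 0) (QP./-cong (sym (ZP.pos-* T d)) (NP.*-identityʳ (suc q')))

‖/·‖-≥ : ∀ T d q .{{_ : N.NonZero q}} K r z →
         z N.* q N.+ K N.≤ T N.* d N.+ r → T N.* d N.+ K N.≤ suc z N.* q N.+ r →
         (+ K - + r) / q Q.≤ ‖ (+ T / q) Q.* ℕ→ℚ d ‖
‖/·‖-≥ T d (suc q') K r z lower upper rewrite /·ℕ→ℚ T d q' =
  ‖/‖-≥ {z = + z} q'
    (subst (λ zq → zq + (+ K - + r) ≤ + (T N.* d)) (ZP.pos-* z (suc q')) (m+k≤n+r⇒m+[k-r]≤n lower))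
    (subst (λ zq → + (T N.* d) + (+ K - + r) ≤ zq) (ZP.pos-* (suc z) (suc q')) (m+k≤n+r⇒m+[k-r]≤n upper))

κ≥-intro : ∀ {D c} t → All (λ d → c Q.≤ ‖ t Q.* ℕ→ℚ d ‖) D → κ≥ D c
κ≥-intro {c = c} t c≤‖td‖ ε 0<ε = t , All.map (QP.≤-trans c-ε≤c) c≤‖td‖
  where
  c-ε≤c : c Q.- ε Q.≤ c
  c-ε≤c = subst (c Q.- ε Q.≤_) (QP.+-identityʳ c) (QP.+-monoʳ-≤ c (QP.neg-antimono-≤ (QP.<⇒≤ 0<ε)))

m+o≡n⇒m≤n : ∀ {m n} o → m N.+ o ≡ n → m N.≤ n
m+o≡n⇒m≤n {m} o refl = NP.m≤m+n m o

data Parity : ℕ → Set where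
  even : ∀ K → Parity (2 N.* K)
  odd  : ∀ K → Parity (2 N.* K N.+ 1)

parity : ∀ k → Parity k
parity zero = even 0
parity (suc k) with parity k
... | even K = subst Parity (NP.+-comm (2 N.* K) 1) (odd K)
... | odd K = subst Parity (2[1+K]≡1+[2K+1] K) (even (suc K))
  where
  2[1+K]≡1+[2K+1] : ∀ K → 2 N.* suc K ≡ suc (2 N.* K N.+ 1)
  2[1+K]≡1+[2K+1] = NSolver.solve-∀

‖½·odd‖-≥ : ∀ k r e → (+ k - + r) / (2 N.* suc k) Q.≤ ‖ (+ suc k / (2 N.* suc k)) Q.* ℕ→ℚ (2 N.* e N.+ 1) ‖
‖½·odd‖-≥ k r e = ‖/·‖-≥ (suc k) (2 N.* e N.+ 1) (2 N.* suc k) k r e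
  (m+o≡n⇒m≤n (suc r) (lower k r e)) (m+o≡n⇒m≤n (suc r) (upper k r e))
  where
  lower : ∀ k r e → e N.* (2 N.* suc k) N.+ k N.+ suc r ≡ suc k N.* (2 N.* e N.+ 1) N.+ r
  lower = NSolver.solve-∀
  upper : ∀ k r e → suc k N.* (2 N.* e N.+ 1) N.+ k N.+ suc r ≡ suc e N.* (2 N.* suc k) N.+ r
  upper = NSolver.solve-∀

Admissible : ℕ → ℕ → ℕ → ℕ → Set
Admissible n k A a = n N.* (2 N.* A N.+ 1) N.≤ a N.* (k N.+ 1) × a N.* (k N.+ 1) N.≤ (n N.+ 1) N.* (2 N.* A N.+ 1)

-- Both witnesses are written over the denominator 2(k + 1) of the bound: t = 1/2 for odd k, and
-- t = (K + A + 1)/(2K + 1) for k = 2K.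
κ≥-lower-bound : ∀ n k A a → Admissible n k A a →
                 κ≥ (1 ∷ 2 N.* n N.+ 1 ∷ k ∷ []) ((+ k - + (2 N.* A)) / (2 N.* suc k))
κ≥-lower-bound n k A a admissible with parity k
κ≥-lower-bound n .(2 N.* K N.+ 1) A a _ | odd K =
  κ≥-intro (+ suc k / (2 N.* suc k)) (‖½·odd‖-≥ k (2 N.* A) 0 ∷ ‖½·odd‖-≥ k (2 N.* A) n ∷ ‖½·odd‖-≥ k (2 N.* A) K ∷ [])
  where
  k : ℕ
  k = 2 N.* K N.+ 1
κ≥-lower-bound n .(2 N.* K) A a (lo , hi) | even K = κ≥-intro t (at-1 ∷ at-j ∷ at-k ∷ [])
  where
  T q : ℕ
  T = 2 N.* K N.+ 2 N.* A N.+ 2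
  q = 2 N.* suc (2 N.* K)
  c t : ℚ
  c = (+ (2 N.* K) - + (2 N.* A)) / q
  t = + T / q
  c≤‖t·_‖ : ℕ → Set
  c≤‖t· d ‖ = c Q.≤ ‖ t Q.* ℕ→ℚ d ‖
  at-1 : c≤‖t· 1 ‖
  at-1 = ‖/·‖-≥ T 1 q (2 N.* K) (2 N.* A) 0
    (m+o≡n⇒m≤n (2 N.+ 4 N.* A) (lower K A)) (m+o≡n⇒m≤n 0 (upper K A))
    where
    lower : ∀ K A → 0 N.* (2 N.* suc (2 N.* K)) N.+ 2 N.* K N.+ (2 N.+ 4 N.* A) ≡ (2 N.* K N.+ 2 N.* A N.+ 2) N.* 1 N.+ 2 N.* A
    lower = NSolver.solve-∀
    upper : ∀ K A → (2 N.* K N.+ 2 N.* A N.+ 2) N.* 1 N.+ 2 N.* K N.+ 0 ≡ 1 N.* (2 N.* suc (2 N.* K)) N.+ 2 N.* A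
    upper = NSolver.solve-∀
  at-k : c≤‖t· 2 N.* K ‖
  at-k = ‖/·‖-≥ T (2 N.* K) q (2 N.* K) (2 N.* A) (K N.+ A)
    (m+o≡n⇒m≤n 0 (lower K A)) (m+o≡n⇒m≤n (2 N.+ 4 N.* A) (upper K A))
    where
    lower : ∀ K A → (K N.+ A) N.* (2 N.* suc (2 N.* K)) N.+ 2 N.* K N.+ 0 ≡ (2 N.* K N.+ 2 N.* A N.+ 2) N.* (2 N.* K) N.+ 2 N.* A
    lower = NSolver.solve-∀
    upper : ∀ K A → (2 N.* K N.+ 2 N.* A N.+ 2) N.* (2 N.* K) N.+ 2 N.* K N.+ (2 N.+ 4 N.* A) ≡ suc (K N.+ A) N.* (2 N.* suc (2 N.* K)) N.+ 2 N.* A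
    upper = NSolver.solve-∀
  at-j : c≤‖t· 2 N.* n N.+ 1 ‖
  at-j = ‖/·‖-≥ T (2 N.* n N.+ 1) q (2 N.* K) (2 N.* A) (n N.+ a) lower upper
    where
    open NP.≤-Reasoning
    rest₁ rest₂ : ℕ
    rest₁ = 2 N.* n N.* (2 N.* K N.+ 1) N.+ 2 N.* K
    rest₂ = 2 N.* (n N.+ 1) N.* (2 N.* K N.+ 1) N.+ 2 N.* A
    lower : (n N.+ a) N.* (2 N.* suc (2 N.* K)) N.+ 2 N.* K N.≤ T N.* (2 N.* n N.+ 1) N.+ 2 N.* A
    lower = begin
      (n N.+ a) N.* (2 N.* suc (2 N.* K)) N.+ 2 N.* K ≡⟨ eq₁ n a K ⟩
      2 N.* (a N.* (2 N.* K N.+ 1)) N.+ rest₁         ≤⟨ NP.+-monoˡ-≤ rest₁ (NP.*-monoʳ-≤ 2 hi) ⟩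
      2 N.* ((n N.+ 1) N.* (2 N.* A N.+ 1)) N.+ rest₁ ≡⟨ eq₂ n K A ⟩
      T N.* (2 N.* n N.+ 1) N.+ 2 N.* A               ∎
      where
      eq₁ : ∀ n a K → (n N.+ a) N.* (2 N.* suc (2 N.* K)) N.+ 2 N.* K
                      ≡ 2 N.* (a N.* (2 N.* K N.+ 1)) N.+ (2 N.* n N.* (2 N.* K N.+ 1) N.+ 2 N.* K)
      eq₁ = NSolver.solve-∀
      eq₂ : ∀ n K A → 2 N.* ((n N.+ 1) N.* (2 N.* A N.+ 1)) N.+ (2 N.* n N.* (2 N.* K N.+ 1) N.+ 2 N.* K)
                      ≡ (2 N.* K N.+ 2 N.* A N.+ 2) N.* (2 N.* n N.+ 1) N.+ 2 N.* A
      eq₂ = NSolver.solve-∀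
    upper : T N.* (2 N.* n N.+ 1) N.+ 2 N.* K N.≤ suc (n N.+ a) N.* (2 N.* suc (2 N.* K)) N.+ 2 N.* A
    upper = begin
      T N.* (2 N.* n N.+ 1) N.+ 2 N.* K               ≡⟨ eq₁ n K A ⟩
      2 N.* (n N.* (2 N.* A N.+ 1)) N.+ rest₂         ≤⟨ NP.+-monoˡ-≤ rest₂ (NP.*-monoʳ-≤ 2 lo) ⟩
      2 N.* (a N.* (2 N.* K N.+ 1)) N.+ rest₂         ≡⟨ eq₂ n a K A ⟩
      suc (n N.+ a) N.* (2 N.* suc (2 N.* K)) N.+ 2 N.* A ∎
      where
      eq₁ : ∀ n K A → (2 N.* K N.+ 2 N.* A N.+ 2) N.* (2 N.* n N.+ 1) N.+ 2 N.* K
                      ≡ 2 N.* (n N.* (2 N.* A N.+ 1)) N.+ (2 N.* (n N.+ 1) N.* (2 N.* K N.+ 1) N.+ 2 N.* A)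
      eq₁ = NSolver.solve-∀
      eq₂ : ∀ n a K A → 2 N.* (a N.* (2 N.* K N.+ 1)) N.+ (2 N.* (n N.+ 1) N.* (2 N.* K N.+ 1) N.+ 2 N.* A)
                        ≡ suc (n N.+ a) N.* (2 N.* suc (2 N.* K)) N.+ 2 N.* A
      eq₂ = NSolver.solve-∀

[k/2-A]/[k+1]≡[k-2A]/[2+2k] : ∀ k' A → let k = suc k' in
                              ((+ k / 2) Q.- ℕ→ℚ A) Q.* (+ 1 / (k N.+ 1)) ≡ (+ k - + (2 N.* A)) / (2 N.* suc k)
[k/2-A]/[k+1]≡[k-2A]/[2+2k] k' A = begin
  ((+ k / 2) Q.- ℕ→ℚ A) Q.* (+ 1 / (k N.+ 1))
    ≡⟨ cong₂ Q._*_ (/-‿-/ (+ k) (+ A) 1 0) (QP./-cong {p₁ = + 1} refl (NP.+-comm k 1)) ⟩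
  ((+ k * 1ℤ - + A * + 2) / 2) Q.* (+ 1 / suc k)
    ≡⟨ /-*-/ (+ k * 1ℤ - + A * + 2) (+ 1) 1 k ⟩
  ((+ k * 1ℤ - + A * + 2) * + 1) / (2 N.* suc k)
    ≡⟨ QP./-cong (trans (numerator (+ k) (+ A)) (cong (λ 2A → + k - 2A) (sym (ZP.pos-* 2 A)))) refl ⟩
  (+ k - + (2 N.* A)) / (2 N.* suc k) ∎
  where
  open ≡-Reasoning
  k : ℕ
  k = suc k'
  numerator : ∀ k A → (k * 1ℤ - A * + 2) * + 1 ≡ k - + 2 * A
  numerator = solve-∀

ℚ-ring : ACR.AlmostCommutativeRing 0ℓ 0ℓ
ℚ-ring = ACR.fromCommutativeRing QP.+-*-commutativeRing is-zero
  where
  is-zero : ∀ p → Maybe (0ℚ ≡ p)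
  is-zero p with 0ℚ QP.≟ p
  ... | yes 0≡p = just 0≡p
  ... | no _ = nothing

ℕ→ℚ-+ : ∀ m n → ℕ→ℚ (m N.+ n) ≡ ℕ→ℚ m Q.+ ℕ→ℚ n
ℕ→ℚ-+ m n = sym (trans (/-+-/ (+ m) (+ n) 0 0)
  (QP./-cong (cong₂ _+_ (ZP.*-identityʳ (+ m)) (ZP.*-identityʳ (+ n))) refl))

x-u-[1+a]+1≡x-[u+a] : ∀ x u a → x Q.- ℕ→ℚ u Q.- ℕ→ℚ (suc a) Q.+ 1ℚ ≡ x Q.- ℕ→ℚ (u N.+ a)
x-u-[1+a]+1≡x-[u+a] x u a rewrite ℕ→ℚ-+ 1 a | ℕ→ℚ-+ u a = shift x (ℕ→ℚ u) (ℕ→ℚ a)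
  where
  shift : ∀ x u a → x Q.- u Q.- (1ℚ Q.+ a) Q.+ 1ℚ ≡ x Q.- (u Q.+ a)
  shift = RingSolver.solve-∀ ℚ-ring

/≤ℕ→ℚ⇒≤ : ∀ {p s} i a .{{_ : N.NonZero a}} b → i + + s ≡ + p → i / a Q.≤ ℕ→ℚ b → p N.≤ b N.* a N.+ s
/≤ℕ→ℚ⇒≤ {p} {s} i a b i+s≡p i/a≤b = ZP.drop‿+≤+ (subst₂ _≤_
  (trans (cong (_+ + s) (ZP.*-identityʳ i)) i+s≡p)
  (cong (_+ + s) (sym (ZP.pos-* b a)))
  (ZP.+-monoˡ-≤ (+ s) (/≤/⇒*≤* i (+ b) a 1 i/a≤b)))

ℕ→ℚ≤/⇒≤ : ∀ {p s} i a .{{_ : N.NonZero a}} b → i + + s ≡ + p → ℕ→ℚ b Q.≤ i / a → b N.* a N.+ s N.≤ p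
ℕ→ℚ≤/⇒≤ {p} {s} i a b i+s≡p b≤i/a = ZP.drop‿+≤+ (subst₂ _≤_
  (cong (_+ + s) (sym (ZP.pos-* b a)))
  (trans (cong (_+ + s) (ZP.*-identityʳ i)) i+s≡p)
  (ZP.+-monoˡ-≤ (+ s) (/≤/⇒*≤* (+ b) i 1 a b≤i/a)))

range₁⇒admissible : ∀ n a .{{_ : N.NonZero a}} m kbar k →
  k ≡ m N.* (2 N.* n N.+ 1 N.+ 1) N.+ kbar →
  ((+ n - + a - + (2 N.* a N.* m)) / a) Q.≤ ℕ→ℚ kbar → ℕ→ℚ kbar Q.≤ ((+ n - + a + + 1) / a) →
  Admissible n k (a N.* m) a
range₁⇒admissible n a m kbar _ refl lo hi = lower , upper
  where
  open NP.≤-Reasoning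
  n≤ : n N.≤ kbar N.* a N.+ (a N.+ 2 N.* a N.* m)
  n≤ = /≤ℕ→ℚ⇒≤ (+ n - + a - + (2 N.* a N.* m)) a kbar (cancel (+ n) (+ a) (+ (2 N.* a N.* m))) lo
    where
    cancel : ∀ n a M → n - a - M + (a + M) ≡ n
    cancel = solve-∀
  ≤n+1 : kbar N.* a N.+ a N.≤ n N.+ 1
  ≤n+1 = ℕ→ℚ≤/⇒≤ (+ n - + a + + 1) a kbar (cancel (+ n) (+ a)) hi
    where
    cancel : ∀ n a → n - a + 1ℤ + a ≡ n + 1ℤ
    cancel = solve-∀
  lower : n N.* (2 N.* (a N.* m) N.+ 1) N.≤ a N.* (m N.* (2 N.* n N.+ 1 N.+ 1) N.+ kbar N.+ 1)
  lower = begin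
    n N.* (2 N.* (a N.* m) N.+ 1)                                     ≡⟨ eq₁ n a m ⟩
    2 N.* (a N.* m) N.* n N.+ n                                       ≤⟨ NP.+-monoʳ-≤ (2 N.* (a N.* m) N.* n) n≤ ⟩
    2 N.* (a N.* m) N.* n N.+ (kbar N.* a N.+ (a N.+ 2 N.* a N.* m)) ≡⟨ eq₂ n a m kbar ⟩
    a N.* (m N.* (2 N.* n N.+ 1 N.+ 1) N.+ kbar N.+ 1)               ∎
    where
    eq₁ : ∀ n a m → n N.* (2 N.* (a N.* m) N.+ 1) ≡ 2 N.* (a N.* m) N.* n N.+ n
    eq₁ = NSolver.solve-∀
    eq₂ : ∀ n a m kbar → 2 N.* (a N.* m) N.* n N.+ (kbar N.* a N.+ (a N.+ 2 N.* a N.* m))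
                         ≡ a N.* (m N.* (2 N.* n N.+ 1 N.+ 1) N.+ kbar N.+ 1)
    eq₂ = NSolver.solve-∀
  upper : a N.* (m N.* (2 N.* n N.+ 1 N.+ 1) N.+ kbar N.+ 1) N.≤ (n N.+ 1) N.* (2 N.* (a N.* m) N.+ 1)
  upper = begin
    a N.* (m N.* (2 N.* n N.+ 1 N.+ 1) N.+ kbar N.+ 1)  ≡⟨ eq₁ n a m kbar ⟩
    2 N.* (a N.* m) N.* (n N.+ 1) N.+ (kbar N.* a N.+ a) ≤⟨ NP.+-monoʳ-≤ (2 N.* (a N.* m) N.* (n N.+ 1)) ≤n+1 ⟩
    2 N.* (a N.* m) N.* (n N.+ 1) N.+ (n N.+ 1)          ≡⟨ eq₂ n a m ⟩
    (n N.+ 1) N.* (2 N.* (a N.* m) N.+ 1)                ∎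
    where
    eq₁ : ∀ n a m kbar → a N.* (m N.* (2 N.* n N.+ 1 N.+ 1) N.+ kbar N.+ 1)
                         ≡ 2 N.* (a N.* m) N.* (n N.+ 1) N.+ (kbar N.* a N.+ a)
    eq₁ = NSolver.solve-∀
    eq₂ : ∀ n a m → 2 N.* (a N.* m) N.* (n N.+ 1) N.+ (n N.+ 1) ≡ (n N.+ 1) N.* (2 N.* (a N.* m) N.+ 1)
    eq₂ = NSolver.solve-∀

range₂⇒admissible : ∀ n a' m kbar k → let a = suc a' in
  k ≡ m N.* (2 N.* n N.+ 1 N.+ 1) N.+ kbar →
  ((+ (2 N.* a N.* n) - + n - + a - + (2 N.* a N.* m)) / a) Q.≤ ℕ→ℚ kbar →
  ℕ→ℚ kbar Q.≤ ((+ (2 N.* a N.* n) - + n + + a - + 1) / a) →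
  Admissible n k (a N.* m N.+ a') a
range₂⇒admissible n a' m kbar _ refl lo hi = NP.+-cancelʳ-≤ n _ _ lower , NP.+-cancelʳ-≤ (n N.+ 1) _ _ upper
  where
  open NP.≤-Reasoning
  a : ℕ
  a = suc a'
  2an≤ : 2 N.* a N.* n N.≤ kbar N.* a N.+ (n N.+ a N.+ 2 N.* a N.* m)
  2an≤ = /≤ℕ→ℚ⇒≤ (+ (2 N.* a N.* n) - + n - + a - + (2 N.* a N.* m)) a kbar
    (cancel (+ (2 N.* a N.* n)) (+ n) (+ a) (+ (2 N.* a N.* m))) lo
    where
    cancel : ∀ X n a M → X - n - a - M + (n + a + M) ≡ X
    cancel = solve-∀
  ≤2an+a : kbar N.* a N.+ (n N.+ 1) N.≤ 2 N.* a N.* n N.+ a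
  ≤2an+a = ℕ→ℚ≤/⇒≤ (+ (2 N.* a N.* n) - + n + + a - + 1) a kbar
    (cancel (+ (2 N.* a N.* n)) (+ n) (+ a)) hi
    where
    cancel : ∀ X n a → X - n + a - 1ℤ + (n + 1ℤ) ≡ X + a
    cancel = solve-∀
  lower : n N.* (2 N.* (a N.* m N.+ a') N.+ 1) N.+ n N.≤ a N.* (m N.* (2 N.* n N.+ 1 N.+ 1) N.+ kbar N.+ 1) N.+ n
  lower = begin
    n N.* (2 N.* (a N.* m N.+ a') N.+ 1) N.+ n                         ≡⟨ eq₁ n a' m ⟩
    2 N.* (a N.* m) N.* n N.+ 2 N.* a N.* n                             ≤⟨ NP.+-monoʳ-≤ (2 N.* (a N.* m) N.* n) 2an≤ ⟩
    2 N.* (a N.* m) N.* n N.+ (kbar N.* a N.+ (n N.+ a N.+ 2 N.* a N.* m)) ≡⟨ eq₂ n a' m kbar ⟩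
    a N.* (m N.* (2 N.* n N.+ 1 N.+ 1) N.+ kbar N.+ 1) N.+ n            ∎
    where
    eq₁ : ∀ n a' m → n N.* (2 N.* (suc a' N.* m N.+ a') N.+ 1) N.+ n ≡ 2 N.* (suc a' N.* m) N.* n N.+ 2 N.* suc a' N.* n
    eq₁ = NSolver.solve-∀
    eq₂ : ∀ n a' m kbar → 2 N.* (suc a' N.* m) N.* n N.+ (kbar N.* suc a' N.+ (n N.+ suc a' N.+ 2 N.* suc a' N.* m))
                          ≡ suc a' N.* (m N.* (2 N.* n N.+ 1 N.+ 1) N.+ kbar N.+ 1) N.+ n
    eq₂ = NSolver.solve-∀
  upper : a N.* (m N.* (2 N.* n N.+ 1 N.+ 1) N.+ kbar N.+ 1) N.+ (n N.+ 1)
          N.≤ (n N.+ 1) N.* (2 N.* (a N.* m N.+ a') N.+ 1) N.+ (n N.+ 1)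
  upper = begin
    a N.* (m N.* (2 N.* n N.+ 1 N.+ 1) N.+ kbar N.+ 1) N.+ (n N.+ 1)   ≡⟨ eq₁ n a' m kbar ⟩
    2 N.* (a N.* m) N.* (n N.+ 1) N.+ a N.+ (kbar N.* a N.+ (n N.+ 1)) ≤⟨ NP.+-monoʳ-≤ (2 N.* (a N.* m) N.* (n N.+ 1) N.+ a) ≤2an+a ⟩
    2 N.* (a N.* m) N.* (n N.+ 1) N.+ a N.+ (2 N.* a N.* n N.+ a)      ≡⟨ eq₂ n a' m ⟩
    (n N.+ 1) N.* (2 N.* (a N.* m N.+ a') N.+ 1) N.+ (n N.+ 1)         ∎
    where
    eq₁ : ∀ n a' m kbar → suc a' N.* (m N.* (2 N.* n N.+ 1 N.+ 1) N.+ kbar N.+ 1) N.+ (n N.+ 1)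
                          ≡ 2 N.* (suc a' N.* m) N.* (n N.+ 1) N.+ suc a' N.+ (kbar N.* suc a' N.+ (n N.+ 1))
    eq₁ = NSolver.solve-∀
    eq₂ : ∀ n a' m → 2 N.* (suc a' N.* m) N.* (n N.+ 1) N.+ suc a' N.+ (2 N.* suc a' N.* n N.+ suc a')
                     ≡ (n N.+ 1) N.* (2 N.* (suc a' N.* m N.+ a') N.+ 1) N.+ (n N.+ 1)
    eq₂ = NSolver.solve-∀

proposition2 : ∀ (n' k' a' m kbar : ℕ) →
    let n = suc n'
        k = suc k'
        a = suc a'
        j = 2 N.* n N.+ 1
        D = 1 ∷ j ∷ k ∷ []
    in k ≡ m N.* (j N.+ 1) N.+ kbar →
       kbar N.≤ j →
       ((((+ n Z.- + a Z.- + (2 N.* a N.* m)) / a) Q.≤ ℕ→ℚ kbar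
           × ℕ→ℚ kbar Q.≤ ((+ n Z.- + a Z.+ + 1) / a)) →
         κ≥ D ((((+ k) / 2) Q.- ℕ→ℚ (a N.* m)) Q.* ((+ 1) / (k N.+ 1))))
       ×
       ((((+ (2 N.* a N.* n) Z.- + n Z.- + a Z.- + (2 N.* a N.* m)) / a) Q.≤ ℕ→ℚ kbar
           × ℕ→ℚ kbar Q.≤ ((+ (2 N.* a N.* n) Z.- + n Z.+ + a Z.- + 1) / a)) →
         κ≥ D ((((+ k) / 2) Q.- ℕ→ℚ (a N.* m) Q.- ℕ→ℚ a Q.+ 1ℚ) Q.* ((+ 1) / (k N.+ 1))))
-- The hypothesis k̄ ≤ j only makes the decomposition of k unique; the bound does not need it.
proposition2 n' k' a' m kbar k≡m[j+1]+kbar _ =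
  (λ (lo , hi) → subst (κ≥ D) (sym ([k/2-A]/[k+1]≡[k-2A]/[2+2k] k' (a N.* m)))
    (κ≥-lower-bound n k (a N.* m) a (range₁⇒admissible n a m kbar k k≡m[j+1]+kbar lo hi))) ,
  (λ (lo , hi) → subst (κ≥ D)
    (sym (trans (cong (Q._* (+ 1 / (k N.+ 1))) (x-u-[1+a]+1≡x-[u+a] (+ k / 2) (a N.* m) a'))
                ([k/2-A]/[k+1]≡[k-2A]/[2+2k] k' (a N.* m N.+ a'))))
    (κ≥-lower-bound n k (a N.* m N.+ a') a (range₂⇒admissible n a' m kbar k k≡m[j+1]+kbar lo hi)))
  where
  n k a : ℕ
  n = suc n'
  k = suc k'
  a = suc a'
  D : List ℕ
  D = 1 ∷ 2 N.* n N.+ 1 ∷ k ∷ []
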